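{- Let $\mathbb{F}$ be a finite field with $q$ elements and $n$ a positive integer. Let $N=\frac{q^n-1}{q-1}$ and let $v_1,\dots,v_N$ be an enumeration of the $1$-dimensional subspaces of $\mathbb{F}^n$. Let $K$ be a field of characteristic zero, $R=K[X_1,\dots,X_N]$, $Q=K[x_1,\dots,x_N]$ acting on $R$ by $x_i\circ f=\partial f/\partial X_i$. Let $F=\sum X_{i_1}\cdots X_{i_n}$, summed over all $1\le i_1<\cdots<i_n\le N$ such that $v_{i_1},\dots,v_{i_n}$ form a basis of $\mathbb{F}^n$, and let $\mathcal{A}=Q/\operatorname{Ann}_Q(F)$ with graded components $\mathcal{A}_k$. For each $j$, let $x_j^\perp\in\mathcal{A}_{n-1}$ be the image of $x_{k_1}\cdots x_{k_{n-1}}$ where $v_{k_1},\dots,v_{k_{n-1}}$ is a basis of the hyperplane $v_j^\perp=\{w:\sum_i(v_j)_iw_i=0\}$, and let $g$ be a monomial generating $\mathcal{A}_n$. Then the multiplication map $\mu:\mathcal{A}_1\times\mathcal{A}_{n-1}\to\mathcal{A}_n$ satisfies $\mu(x_i,x_j^\perp)=b_{ij}\,g$ for all $i,j$, where $b_{ij}=0$ if $v_i\in v_j^\perp$ and $b_{ij}=1$ if $v_i\notin v_j^\perp$; that is, with respect to the bases $\{x_i\}$, $\{x_j^\perp\}$, $\{g\}$, the bilinear map $\mu$ is represented by the matrix $B=(b_{ij})$.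
   Context: $\operatorname{Ann}_Q(F)=\{f\in Q:f\circ F=0\}$. It is known that $\{x_1,\dots,x_N\}$, $\{x_1^\perp,\dots,x_N^\perp\}$ are $K$-bases of $\mathcal{A}_1$, $\mathcal{A}_{n-1}$, and $\mathcal{A}_n$ is one-dimensional. -}

module Defs where

open import Level using (Level; _⊔_) renaming (suc to lsuc)
open import Algebra.Bundles using (CommutativeRing)
open import Data.Nat as ℕ using (ℕ; zero; suc)
open import Data.Fin as Fin using (Fin; zero; suc)
open import Data.Product using (Σ; ∃; _×_; _,_)
open import Data.List using (List; []; _∷_; _++_; map)
open import Data.List.Relation.Unary.All using (All)
open import Data.Unit using (⊤)
open import Relation.Nullary using (¬_; yes; no)
open import Relation.Binary.PropositionalEquality using (_≡_)

record Field (c ℓ : Level) : Set (lsuc (c ⊔ ℓ)) where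
  field
    commutativeRing : CommutativeRing c ℓ
  open CommutativeRing commutativeRing public
  field
    0≉1     : ¬ (0# ≈ 1#)
    inverse : ∀ x → ¬ (x ≈ 0#) → ∃ λ y → (x * y) ≈ 1#

module _ {c ℓ : Level} (K : Field c ℓ) where
  open Field K using (Carrier; _≈_; _+_; 0#; 1#)

  ΣK : ∀ {m} → (Fin m → Carrier) → Carrier
  ΣK {zero}  f = 0#
  ΣK {suc m} f = f zero + ΣK (λ s → f (suc s))

  ι : ℕ → Carrier
  ι zero    = 0#
  ι (suc n) = 1# + ι n

  CharZero : Set ℓ
  CharZero = ∀ n → ¬ (ι (suc n) ≈ 0#)

module _ {c ℓ : Level} (𝔽 : Field c ℓ) (n : ℕ) where
  open Field 𝔽 using (Carrier; _≈_; _+_; _*_; 0#; 1#)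

  Vect : Set c
  Vect = Fin n → Carrier

  _≈v_ : Vect → Vect → Set ℓ
  u ≈v w = ∀ t → u t ≈ w t

  0v : Vect
  0v = λ _ → 0#

  lincomb : ∀ {m} → (Fin m → Carrier) → (Fin m → Vect) → Vect
  lincomb cs w = λ t → ΣK 𝔽 (λ k → cs k * w k t)

  LinIndep : ∀ {m} → (Fin m → Vect) → Set (c ⊔ ℓ)
  LinIndep w = ∀ cs → lincomb cs w ≈v 0v → ∀ k → cs k ≈ 0#

  Spans : ∀ {m} {p} → (Vect → Set p) → (Fin m → Vect) → Set (c ⊔ ℓ ⊔ p)
  Spans P w = ∀ u → P u → ∃ λ cs → lincomb cs w ≈v u

  IsBasisOf : ∀ {m} {p} → (Vect → Set p) → (Fin m → Vect) → Set (c ⊔ ℓ ⊔ p)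
  IsBasisOf P w = (∀ k → P (w k)) × LinIndep w × Spans P w

  Whole : Vect → Set
  Whole _ = ⊤

  Perp : Vect → Vect → Set ℓ
  Perp v w = ΣK 𝔽 (λ t → v t * w t) ≈ 0#

  InLine : Vect → Vect → Set (c ⊔ ℓ)
  InLine v w = ∃ λ a → ∀ t → w t ≈ (a * v t)

  -- v_1..v_N enumerates the 1-dimensional subspaces of 𝔽^n
  -- (each subspace is given by a nonzero spanning vector v_i):
  -- each v_i spans a line, every line is spanned by some v_i,
  -- and distinct indices give distinct lines.
  IsLineEnumeration : ∀ {N} → (Fin N → Vect) → Set (c ⊔ ℓ)
  IsLineEnumeration v =
      (∀ i → ¬ (v i ≈v 0v))
    × (∀ w → ¬ (w ≈v 0v) → ∃ λ i → InLine (v i) w)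
    × (∀ i j → InLine (v i) (v j) → i ≡ j)

Exp : ℕ → Set
Exp N = Fin N → ℕ

ΣN : ∀ {m} → (Fin m → ℕ) → ℕ
ΣN {zero}  f = 0
ΣN {suc m} f = f zero ℕ.+ ΣN (λ s → f (suc s))

ΠN : ∀ {m} → (Fin m → ℕ) → ℕ
ΠN {zero}  f = 1
ΠN {suc m} f = f zero ℕ.* ΠN (λ s → f (suc s))

deg : ∀ {N} → Exp N → ℕ
deg a = ΣN a

_+e_ : ∀ {N} → Exp N → Exp N → Exp N
(a +e b) t = a t ℕ.+ b t

var : ∀ {N} → Fin N → Exp N
var i t with i Fin.≟ t
... | yes _ = 1
... | no  _ = 0

monExp : ∀ {N m} → (Fin m → Fin N) → Exp N
monExp k t = ΣN (λ s → var (k s) t)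

fall : ℕ → ℕ → ℕ
fall m       zero    = 1
fall zero    (suc k) = 0
fall (suc m) (suc k) = suc m ℕ.* fall m k

-- R = K[X_1..X_N] (coefficient functions) and Q = K[x_1..x_N]
-- (finite formal sums of terms), with Q acting on R by differentiation.

module _ {c ℓ : Level} (K : Field c ℓ) (N : ℕ) where
  open Field K using (Carrier; _≈_; _+_; _*_; -_; 0#; 1#)

  R : Set c
  R = Exp N → Carrier

  Q : Set c
  Q = List (Carrier × Exp N)

  mono : Exp N → Q
  mono a = (1# , a) ∷ []

  _·Q_ : Q → Q → Q
  []            ·Q h = []
  ((c₁ , a) ∷ f) ·Q h = map (λ { (c₂ , b) → (c₁ * c₂ , a +e b) }) h ++ (f ·Q h)

  scaleQ : Carrier → Q → Q
  scaleQ d = map (λ { (c₁ , a) → (d * c₁ , a) })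

  _-Q_ : Q → Q → Q
  f -Q h = f ++ scaleQ (- 1#) h

  -- x^a ∘ X^(b+a) = (Π_t fall (b_t + a_t) a_t) X^b ; extended linearly
  _∘_ : Q → R → R
  ([]              ∘ f) b = 0#
  (((c₁ , a) ∷ h)  ∘ f) b =
    (c₁ * (ι K (ΠN (λ t → fall (b t ℕ.+ a t) (a t))) * f (b +e a))) + (h ∘ f) b

  InAnn : R → Q → Set ℓ
  InAnn F h = ∀ b → (h ∘ F) b ≈ 0#

  Homog : ℕ → Q → Set c
  Homog d h = All (λ { (_ , a) → deg a ≡ d }) h

  -- the image of g generates A_d = Q_d / (Ann_Q(F) ∩ Q_d) as a K-vector space
  GeneratesA : R → ℕ → Q → Set (c ⊔ ℓ)
  GeneratesA F d g = ∀ h → Homog d h → ∃ λ a → InAnn F (h -Q scaleQ a g)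

-- The polynomial F = Σ X_{i_1} ⋯ X_{i_n} over i_1 < ⋯ < i_n with
-- v_{i_1}, …, v_{i_n} a basis of 𝔽^n, characterised by its coefficients.

module _ {c ℓ c' ℓ' : Level} (𝔽 : Field c ℓ) (K : Field c' ℓ')
         (n N : ℕ) (v : Fin N → Vect 𝔽 n) where

  IsBasisMonomial : Exp N → Set (c ⊔ ℓ)
  IsBasisMonomial a =
    ∃ λ (i : Fin n → Fin N) →
        (∀ s s' → s Fin.< s' → i s Fin.< i s')
      × (∀ t → a t ≡ monExp i t)
      × IsBasisOf 𝔽 n (Whole 𝔽 n) (λ s → v (i s))

  IsBasisPolynomial : R K N → Set (c ⊔ ℓ ⊔ ℓ')
  IsBasisPolynomial F =
    ∀ a → (IsBasisMonomial a → Field._≈_ K (F a) (Field.1# K))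
        × (¬ IsBasisMonomial a → Field._≈_ K (F a) (Field.0# K))

-- F has coefficient 1 exactly at the squarefree monomials X_{i_1}⋯X_{i_n} whose vectors
-- v_{i_1}, …, v_{i_n} form a basis of 𝔽^n ("basis monomials") and 0 elsewhere. Hence for a
-- monomial x^a of degree n, x^a ∘ F is the constant 1 if x^a is a basis monomial and 0
-- otherwise.
-- If v_i ∈ v_j⊥, then v_i lies in the span of the basis v_k of v_j⊥, so x_i x^k is not a basis
-- monomial and annihilates F. Otherwise v_i together with v_k is a basis of 𝔽^n, so x_i x^k is a
-- basis monomial; as g generates 𝒜_n ≠ 0 we get g ∘ F ≠ 0, so g is a basis monomial too (this is
-- decidable because 𝔽 is finite), and x_i x^k − g annihilates F.

module Submission where

open import Defs renaming (_∘_ to _∘Q_)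

open import Level using (Level)
open import Data.Nat as ℕ using (ℕ; zero; suc)
import Data.Fin.Properties as Finₚ
open import Data.Fin as Fin using (Fin; zero; suc)
open import Function.Bundles using (Inverse)
open import Data.Vec.Functional using (_∷_; head; tail)
open import Data.Product using (∃; _×_; _,_; proj₁; proj₂)
open import Data.Empty using (⊥-elim)
open import Data.Unit using (tt)
open import Function.Base using (_∘_)
open import Function.Definitions using (Injective)
open import Relation.Binary.PropositionalEquality using (_≡_; _≢_; _≗_)
import Relation.Binary.PropositionalEquality as ≡
open import Relation.Nullary using (¬_; Dec; yes; no)

module ExponentVectors where

  import Algebra.Properties.CommutativeMonoid.Sum as CommutativeMonoidSum
  open import Data.Nat using (_+_; _≤_; z≤n; s≤s)
  import Data.Nat.Properties as ℕₚ
  open import Data.Fin using (_<_)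
  open import Relation.Binary.Definitions using (tri<; tri≈; tri>)
  open ≡ using (refl; sym; trans; cong; cong₂; subst)

  module ℕSum = CommutativeMonoidSum ℕₚ.+-0-commutativeMonoid

  ΣN≡sum : ∀ {m} (f : Fin m → ℕ) → ΣN f ≡ ℕSum.sum f
  ΣN≡sum {zero}  f = refl
  ΣN≡sum {suc m} f = cong (f zero +_) (ΣN≡sum (f ∘ suc))

  ΣN-cong : ∀ {m} {f g : Fin m → ℕ} → f ≗ g → ΣN f ≡ ΣN g
  ΣN-cong {f = f} {g} f≗g rewrite ΣN≡sum f | ΣN≡sum g = ℕSum.sum-cong-≗ f≗g

  ΣN-distrib-+ : ∀ {m} (f g : Fin m → ℕ) → ΣN (λ s → f s + g s) ≡ ΣN f + ΣN g
  ΣN-distrib-+ f g rewrite ΣN≡sum f | ΣN≡sum g | ΣN≡sum (λ s → f s + g s) =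
    ℕSum.∑-distrib-+ f g

  ΣN-zero : ∀ {m} {f : Fin m → ℕ} → (∀ s → f s ≡ 0) → ΣN f ≡ 0
  ΣN-zero {zero}  f≡0 = refl
  ΣN-zero {suc m} f≡0 = cong₂ _+_ (f≡0 zero) (ΣN-zero (f≡0 ∘ suc))

  ΣN≡0⇒zero : ∀ {m} (f : Fin m → ℕ) → ΣN f ≡ 0 → ∀ s → f s ≡ 0
  ΣN≡0⇒zero f Σ≡0 zero    = ℕₚ.m+n≡0⇒m≡0 (f zero) Σ≡0
  ΣN≡0⇒zero f Σ≡0 (suc s) = ΣN≡0⇒zero (f ∘ suc) (ℕₚ.m+n≡0⇒n≡0 (f zero) Σ≡0) s

  var-diag : ∀ {N} (j : Fin N) → var j j ≡ 1
  var-diag j with j Fin.≟ j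
  ... | yes _   = refl
  ... | no j≢j = ⊥-elim (j≢j refl)

  var-offdiag : ∀ {N} {j t : Fin N} → j ≢ t → var j t ≡ 0
  var-offdiag {j = j} {t} j≢t with j Fin.≟ t
  ... | yes j≡t = ⊥-elim (j≢t j≡t)
  ... | no _    = refl

  var-suc : ∀ {N} (j t : Fin N) → var (suc j) (suc t) ≡ var j t
  var-suc j t = by-cases (j Fin.≟ t)
    where
    by-cases : Dec (j ≡ t) → var (suc j) (suc t) ≡ var j t
    by-cases (yes refl) = trans (var-diag (suc j)) (sym (var-diag j))
    by-cases (no j≢t)   = trans (var-offdiag (j≢t ∘ Finₚ.suc-injective)) (sym (var-offdiag j≢t))

  deg-var : ∀ {N} (j : Fin N) → deg (var j) ≡ 1
  deg-var {suc N} zero =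
    cong₂ _+_ (var-diag {suc N} zero) (ΣN-zero {N} λ t → var-offdiag {j = zero} {suc t} λ ())
  deg-var {suc N} (suc j) =
    cong₂ _+_ (var-offdiag {j = suc j} {zero} λ ()) (trans (ΣN-cong (var-suc j)) (deg-var j))

  deg-monExp : ∀ {m N} (w : Fin m → Fin N) → deg (monExp w) ≡ m
  deg-monExp {zero}  {N} w = ΣN-zero {N} λ t → refl
  deg-monExp {suc m} w =
    trans (ΣN-distrib-+ (var (head w)) (monExp (tail w)))
          (cong₂ _+_ (deg-var (head w)) (deg-monExp (tail w)))

  Squarefree : ∀ {N} → Exp N → Set
  Squarefree a = ∀ t → a t ≤ 1

  StrictlyIncreasing : ∀ {m N} → (Fin m → Fin N) → Set
  StrictlyIncreasing i = ∀ s s' → s < s' → i s < i s'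

  monExp-outside-image : ∀ {m N} (w : Fin m → Fin N) t → (∀ s → w s ≢ t) → monExp w t ≡ 0
  monExp-outside-image w t w≢t = ΣN-zero (var-offdiag ∘ w≢t)

  monExp-on-image : ∀ {m N} (w : Fin m → Fin N) s → 1 ≤ monExp w (w s)
  monExp-on-image w zero    rewrite var-diag (w zero) = s≤s z≤n
  monExp-on-image w (suc s) =
    ℕₚ.≤-trans (monExp-on-image (tail w) s) (ℕₚ.m≤n+m _ (var (head w) (w (suc s))))

  monExp-pos⇒image : ∀ {m N} (w : Fin m → Fin N) t → 1 ≤ monExp w t → ∃ λ s → w s ≡ t
  monExp-pos⇒image w t 1≤ with Finₚ.any? (λ s → w s Fin.≟ t)
  ... | yes image = image
  ... | no ¬image with () ← subst (1 ≤_) (monExp-outside-image w t (λ s e → ¬image (s , e))) 1≤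

  injective⇒squarefree : ∀ {m N} (w : Fin m → Fin N) → Injective _≡_ _≡_ w → Squarefree (monExp w)
  injective⇒squarefree {zero}  w inj t = z≤n
  injective⇒squarefree {suc m} w inj t = by-cases (head w Fin.≟ t)
    where
    by-cases : Dec (head w ≡ t) → var (head w) t + monExp (tail w) t ≤ 1
    by-cases (yes refl)
      rewrite var-diag (head w)
            | monExp-outside-image (tail w) (head w) (λ s e → Finₚ.0≢1+n (inj (sym e))) = s≤s z≤n
    by-cases (no w₀≢t) rewrite var-offdiag w₀≢t =
      injective⇒squarefree (tail w) (Finₚ.suc-injective ∘ inj) t

  squarefree⇒injective : ∀ {m N} (w : Fin m → Fin N) → Squarefree (monExp w) → Injective _≡_ _≡_ w
  squarefree⇒injective {suc m} w sq {zero}  {zero}   e = refl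
  squarefree⇒injective {suc m} w sq {zero}  {suc s'} e = ⊥-elim (head-unrepeated s' e)
    where
    head-unrepeated : ∀ s → head w ≢ w (suc s)
    head-unrepeated s e = ℕₚ.<-irrefl refl (ℕₚ.≤-trans (s≤s twice) once)
      where
      twice : 1 ≤ monExp (tail w) (head w)
      twice = subst (λ t → 1 ≤ monExp (tail w) t) (sym e) (monExp-on-image (tail w) s)
      once : 1 + monExp (tail w) (head w) ≤ 1
      once = subst (_≤ 1) (cong (_+ monExp (tail w) (head w)) (var-diag (head w))) (sq (head w))
  squarefree⇒injective {suc m} w sq {suc s} {zero}   e = sym (squarefree⇒injective w sq (sym e))
  squarefree⇒injective {suc m} w sq {suc s} {suc s'} e =
    cong suc (squarefree⇒injective (tail w) sq-tail e)
    where
    sq-tail : Squarefree (monExp (tail w))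
    sq-tail t = ℕₚ.≤-trans (ℕₚ.m≤n+m (monExp (tail w) t) (var (head w) t)) (sq t)

  strictlyIncreasing⇒injective : ∀ {m N} (i : Fin m → Fin N) → StrictlyIncreasing i →
                                 Injective _≡_ _≡_ i
  strictlyIncreasing⇒injective i inc {s} {s'} e with Finₚ.<-cmp s s'
  ... | tri< s<s' _ _ = ⊥-elim (Finₚ.<-irrefl e (inc s s' s<s'))
  ... | tri≈ _ s≡s' _ = s≡s'
  ... | tri> _ _ s'<s = ⊥-elim (Finₚ.<-irrefl (sym e) (inc s' s s'<s))

  image-transfer : ∀ {m₁ m₂ N} (w₁ : Fin m₁ → Fin N) (w₂ : Fin m₂ → Fin N) →
                   monExp w₁ ≗ monExp w₂ → ∀ s → ∃ λ s' → w₂ s' ≡ w₁ s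
  image-transfer w₁ w₂ w₁≗w₂ s =
    monExp-pos⇒image w₂ (w₁ s) (subst (1 ≤_) (w₁≗w₂ (w₁ s)) (monExp-on-image w₁ s))

  ΠN-one : ∀ {m} {f : Fin m → ℕ} → (∀ s → f s ≡ 1) → ΠN f ≡ 1
  ΠN-one {zero}  f≡1 = refl
  ΠN-one {suc m} f≡1 = cong₂ ℕ._*_ (f≡1 zero) (ΠN-one (f≡1 ∘ suc))

  fall-diag : ∀ {x} → x ≤ 1 → fall x x ≡ 1
  fall-diag z≤n       = refl
  fall-diag (s≤s z≤n) = refl

  monExp-suc : ∀ {m N} (i : Fin m → Fin N) t → monExp (Fin.suc ∘ i) (suc t) ≡ monExp i t
  monExp-suc i t = ΣN-cong (λ s → var-suc (i s) t)

  monExp-suc-zero : ∀ {m N} (i : Fin m → Fin N) → monExp (Fin.suc ∘ i) zero ≡ 0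
  monExp-suc-zero i = monExp-outside-image (Fin.suc ∘ i) zero (λ s ())

  squarefree⇒sorted : ∀ {N} n (a : Exp N) → Squarefree a → deg a ≡ n →
                      ∃ λ (i : Fin n → Fin N) → StrictlyIncreasing i × monExp i ≗ a
  squarefree⇒sorted {zero}  n a sq refl = (λ ()) , (λ ()) , (λ ())
  squarefree⇒sorted {suc N} n a sq deg≡n with a zero in a₀≡ | sq zero
  ... | 0 | _ =
    let i , inc , i≗ = squarefree⇒sorted n (tail a) (sq ∘ suc) deg≡n in
    Fin.suc ∘ i , (λ s s' s<s' → s≤s (inc s s' s<s')) ,
    λ { zero → trans (monExp-suc-zero i) (sym a₀≡) ; (suc t) → trans (monExp-suc i t) (i≗ t) }
  ... | 1 | _ with refl ← deg≡n =
    let i , inc , i≗ = squarefree⇒sorted _ (tail a) (sq ∘ suc) refl in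
    zero ∷ Fin.suc ∘ i , increasing i inc ,
    λ { zero    → trans (cong₂ _+_ (var-diag {suc N} zero) (monExp-suc-zero i)) (sym a₀≡)
      ; (suc t) → trans (cong₂ _+_ (var-offdiag {j = zero} {suc t} λ ()) (monExp-suc i t)) (i≗ t) }
    where
    increasing : ∀ {m} (i : Fin m → Fin N) → StrictlyIncreasing i →
                 StrictlyIncreasing (zero ∷ Fin.suc ∘ i)
    increasing i inc zero    (suc s') _          = s≤s z≤n
    increasing i inc (suc s) (suc s') (s≤s s<s') = s≤s (inc s s' s<s')
  ... | suc (suc _) | s≤s ()

open ExponentVectors

module FieldSums {c ℓ} (K : Field c ℓ) where

  open Field K hiding (zero)
  open import Algebra.Properties.Ring ring using (+-inverseˡ-unique)
  import Algebra.Properties.Semiring.Sum semiring as Sum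
  open import Relation.Binary.Reasoning.Setoid setoid

  ΣK≡sum : ∀ {m} (f : Fin m → Carrier) → ΣK K f ≡ Sum.sum f
  ΣK≡sum {zero}  f = ≡.refl
  ΣK≡sum {suc m} f = ≡.cong (f zero +_) (ΣK≡sum (f ∘ suc))

  ΣK-cong : ∀ {m} {f g : Fin m → Carrier} → (∀ s → f s ≈ g s) → ΣK K f ≈ ΣK K g
  ΣK-cong {f = f} {g} f≈g rewrite ΣK≡sum f | ΣK≡sum g = Sum.sum-cong-≋ f≈g

  ΣK-zero : ∀ {m} {f : Fin m → Carrier} → (∀ s → f s ≈ 0#) → ΣK K f ≈ 0#
  ΣK-zero {m} {f} f≈0 rewrite ΣK≡sum f = trans (Sum.sum-cong-≋ f≈0) (Sum.sum-replicate-zero m)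

  ΣK-distrib-+ : ∀ {m} (f g : Fin m → Carrier) → ΣK K (λ s → f s + g s) ≈ ΣK K f + ΣK K g
  ΣK-distrib-+ f g rewrite ΣK≡sum f | ΣK≡sum g | ΣK≡sum (λ s → f s + g s) = Sum.∑-distrib-+ f g

  ΣK-distrib-- : ∀ {m} (f g : Fin m → Carrier) → ΣK K (λ s → f s - g s) ≈ ΣK K f - ΣK K g
  ΣK-distrib-- f g = trans (ΣK-distrib-+ f (-_ ∘ g)) (+-congˡ ΣK-neg)
    where
    ΣK-neg : ΣK K (-_ ∘ g) ≈ - ΣK K g
    ΣK-neg = +-inverseˡ-unique _ _
      (trans (sym (ΣK-distrib-+ (-_ ∘ g) g)) (ΣK-zero λ s → -‿inverseˡ (g s)))

  *-distribˡ-ΣK : ∀ {m} x (f : Fin m → Carrier) → x * ΣK K f ≈ ΣK K (λ s → x * f s)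
  *-distribˡ-ΣK x f rewrite ΣK≡sum f | ΣK≡sum (λ s → x * f s) = Sum.*-distribˡ-sum x f

  ΣK-comm : ∀ {m p} (f : Fin m → Fin p → Carrier) →
            ΣK K (λ s → ΣK K (f s)) ≈ ΣK K (λ t → ΣK K (λ s → f s t))
  ΣK-comm f = begin
    ΣK K (λ s → ΣK K (f s))
      ≈⟨ ΣK-cong (λ s → reflexive (ΣK≡sum (f s))) ⟩
    ΣK K (λ s → Sum.sum (f s))
      ≡⟨ ΣK≡sum (λ s → Sum.sum (f s)) ⟩
    Sum.sum (λ s → Sum.sum (f s))
      ≈⟨ Sum.∑-comm f ⟩
    Sum.sum (λ t → Sum.sum (λ s → f s t))
      ≡⟨ ≡.sym (ΣK≡sum (λ t → Sum.sum (λ s → f s t))) ⟩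
    ΣK K (λ t → Sum.sum (λ s → f s t))
      ≈⟨ ΣK-cong (λ t → reflexive (≡.sym (ΣK≡sum (λ s → f s t)))) ⟩
    ΣK K (λ t → ΣK K (λ s → f s t)) ∎

  ι-homo-+ : ∀ a b → ι K (a ℕ.+ b) ≈ ι K a + ι K b
  ι-homo-+ zero    b = sym (+-identityˡ _)
  ι-homo-+ (suc a) b = trans (+-congˡ (ι-homo-+ a b)) (sym (+-assoc 1# _ _))

  ι-one : ι K 1 ≈ 1#
  ι-one = +-identityʳ 1#

  ι-var-diag : ∀ {N} (j : Fin N) → ι K (var j j) ≈ 1#
  ι-var-diag j = trans (reflexive (≡.cong (ι K) (var-diag j))) ι-one

  ι-var-offdiag : ∀ {N} {j t : Fin N} → j ≢ t → ι K (var j t) ≈ 0#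
  ι-var-offdiag j≢t = reflexive (≡.cong (ι K) (var-offdiag j≢t))

  ΣK-indicator : ∀ {N} (j : Fin N) (f : Fin N → Carrier) → ΣK K (λ t → ι K (var j t) * f t) ≈ f j
  ΣK-indicator {suc N} zero f = begin
    ι K (var {suc N} zero zero) * f zero + ΣK K (λ t → ι K (var zero (suc t)) * f (suc t))
      ≈⟨ +-cong (*-congʳ (ι-var-diag {suc N} zero))
                (ΣK-zero {N} λ t → trans (*-congʳ (ι-var-offdiag {j = zero} {suc t} λ ())) (zeroˡ _)) ⟩
    1# * f zero + 0#  ≈⟨ trans (+-identityʳ _) (*-identityˡ _) ⟩
    f zero            ∎
  ΣK-indicator {suc N} (suc j) f = begin
    ι K (var (suc j) zero) * f zero + ΣK K (λ t → ι K (var (suc j) (suc t)) * f (suc t))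
      ≈⟨ +-cong (trans (*-congʳ (ι-var-offdiag {j = suc j} {zero} λ ())) (zeroˡ _))
                (ΣK-cong λ t → *-congʳ (reflexive (≡.cong (ι K) (var-suc j t)))) ⟩
    0# + ΣK K (λ t → ι K (var j t) * f (suc t))  ≈⟨ +-identityˡ _ ⟩
    ΣK K (λ t → ι K (var j t) * f (suc t))       ≈⟨ ΣK-indicator j (f ∘ suc) ⟩
    f (suc j)                                    ∎

  ΣK-∘≈ΣK-monExp : ∀ {m N} (w : Fin m → Fin N) (f : Fin N → Carrier) →
                   ΣK K (f ∘ w) ≈ ΣK K (λ t → ι K (monExp w t) * f t)
  ΣK-∘≈ΣK-monExp {zero}  w f = sym (ΣK-zero λ t → zeroˡ (f t))
  ΣK-∘≈ΣK-monExp {suc m} w f = begin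
    f (head w) + ΣK K (f ∘ tail w)
      ≈⟨ +-cong (sym (ΣK-indicator (head w) f)) (ΣK-∘≈ΣK-monExp (tail w) f) ⟩
    ΣK K (λ t → ι K (var (head w) t) * f t) + ΣK K (λ t → ι K (monExp (tail w) t) * f t)
      ≈⟨ sym (ΣK-distrib-+ (λ t → ι K (var (head w) t) * f t)
                           (λ t → ι K (monExp (tail w) t) * f t)) ⟩
    ΣK K (λ t → ι K (var (head w) t) * f t + ι K (monExp (tail w) t) * f t)
      ≈⟨ ΣK-cong (λ t → trans (sym (distribʳ (f t) _ _))
                              (*-congʳ (sym (ι-homo-+ (var (head w) t) (monExp (tail w) t))))) ⟩
    ΣK K (λ t → ι K (monExp w t) * f t) ∎

  ΣK-reindex : ∀ {m₁ m₂ N} (w₁ : Fin m₁ → Fin N) (w₂ : Fin m₂ → Fin N) →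
               monExp w₁ ≗ monExp w₂ → (f : Fin N → Carrier) → ΣK K (f ∘ w₁) ≈ ΣK K (f ∘ w₂)
  ΣK-reindex w₁ w₂ w₁≗w₂ f = begin
    ΣK K (f ∘ w₁)
      ≈⟨ ΣK-∘≈ΣK-monExp w₁ f ⟩
    ΣK K (λ t → ι K (monExp w₁ t) * f t)
      ≈⟨ ΣK-cong (λ t → *-congʳ (reflexive (≡.cong (ι K) (w₁≗w₂ t)))) ⟩
    ΣK K (λ t → ι K (monExp w₂ t) * f t)
      ≈⟨ sym (ΣK-∘≈ΣK-monExp w₂ f) ⟩
    ΣK K (f ∘ w₂) ∎

module LinearAlgebra {c ℓ} (𝔽 : Field c ℓ) (n : ℕ) where

  open Field 𝔽 hiding (zero)
  open FieldSums 𝔽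
  open import Algebra.Properties.Ring ring
    using (-‿involutive; -0#≈0#; -1*x≈-x; x[y-z]≈xy-xz; [y-z]x≈yx-zx; xyx⁻¹≈y)
  open import Algebra.Properties.CommutativeSemigroup *-commutativeSemigroup using (x∙yz≈y∙xz)
  open import Relation.Binary.Reasoning.Setoid setoid

  _·_ : Vect 𝔽 n → Vect 𝔽 n → Carrier
  x · y = ΣK 𝔽 (λ t → x t * y t)

  ·-congˡ : ∀ x {y z} → _≈v_ 𝔽 n y z → x · y ≈ x · z
  ·-congˡ x y≈z = ΣK-cong (λ t → *-congˡ (y≈z t))

  ·-zeroʳ : ∀ x → x · 0v 𝔽 n ≈ 0#
  ·-zeroʳ x = ΣK-zero (λ t → zeroʳ (x t))

  ·-lincomb : ∀ {m} x (cs : Fin m → Carrier) (w : Fin m → Vect 𝔽 n) →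
              x · lincomb 𝔽 n cs w ≈ ΣK 𝔽 (λ s → cs s * (x · w s))
  ·-lincomb x cs w = begin
    ΣK 𝔽 (λ t → x t * ΣK 𝔽 (λ s → cs s * w s t))
      ≈⟨ ΣK-cong (λ t → *-distribˡ-ΣK (x t) λ s → cs s * w s t) ⟩
    ΣK 𝔽 (λ t → ΣK 𝔽 (λ s → x t * (cs s * w s t)))
      ≈⟨ sym (ΣK-comm λ s t → x t * (cs s * w s t)) ⟩
    ΣK 𝔽 (λ s → ΣK 𝔽 (λ t → x t * (cs s * w s t)))
      ≈⟨ ΣK-cong (λ s → ΣK-cong λ t → x∙yz≈y∙xz (x t) (cs s) (w s t)) ⟩
    ΣK 𝔽 (λ s → ΣK 𝔽 (λ t → cs s * (x t * w s t)))
      ≈⟨ ΣK-cong (λ s → sym (*-distribˡ-ΣK (cs s) λ t → x t * w s t)) ⟩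
    ΣK 𝔽 (λ s → cs s * (x · w s)) ∎

  ·-linearʳ : ∀ x y z a → x · (λ t → y t - a * z t) ≈ x · y - a * (x · z)
  ·-linearʳ x y z a = begin
    ΣK 𝔽 (λ t → x t * (y t - a * z t))
      ≈⟨ ΣK-cong (λ t → trans (x[y-z]≈xy-xz (x t) (y t) (a * z t))
                              (+-congˡ (-‿cong (x∙yz≈y∙xz (x t) a (z t))))) ⟩
    ΣK 𝔽 (λ t → x t * y t - a * (x t * z t))
      ≈⟨ ΣK-distrib-- (λ t → x t * y t) (λ t → a * (x t * z t)) ⟩
    x · y - ΣK 𝔽 (λ t → a * (x t * z t))
      ≈⟨ +-congˡ (-‿cong (sym (*-distribˡ-ΣK a λ t → x t * z t))) ⟩
    x · y - a * (x · z) ∎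

  lincomb-cong : ∀ {m} {cs ds : Fin m → Carrier} (w : Fin m → Vect 𝔽 n) →
                 (∀ s → cs s ≈ ds s) → _≈v_ 𝔽 n (lincomb 𝔽 n cs w) (lincomb 𝔽 n ds w)
  lincomb-cong w cs≈ds t = ΣK-cong (λ s → *-congʳ (cs≈ds s))

  x*y≈0⇒x≈0 : ∀ {x y} → ¬ (y ≈ 0#) → x * y ≈ 0# → x ≈ 0#
  x*y≈0⇒x≈0 {x} {y} y≉0 xy≈0 = begin
    x             ≈⟨ sym (*-identityʳ x) ⟩
    x * 1#        ≈⟨ *-congˡ (sym (proj₂ (inverse y y≉0))) ⟩
    x * (y * y⁻¹) ≈⟨ sym (*-assoc x y y⁻¹) ⟩
    (x * y) * y⁻¹ ≈⟨ *-congʳ xy≈0 ⟩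
    0# * y⁻¹      ≈⟨ zeroˡ y⁻¹ ⟩
    0#            ∎
    where y⁻¹ = proj₁ (inverse y y≉0)

  linIndep⇒distinct : ∀ {m} (w : Fin m → Vect 𝔽 n) → LinIndep 𝔽 n w →
                      ∀ r r' → _≈v_ 𝔽 n (w r) (w r') → r ≡ r'
  linIndep⇒distinct {m} w li r r' wr≈wr' with r Fin.≟ r'
  ... | yes r≡r' = r≡r'
  ... | no r≢r'  = ⊥-elim (0≉1 (sym (trans (sym cs-r≈1) (li cs lincomb≈0 r))))
    where
    δ : Fin m → Fin m → Carrier
    δ r s = ι 𝔽 (var r s)

    cs : Fin m → Carrier
    cs s = δ r s - δ r' s

    cs-r≈1 : cs r ≈ 1#
    cs-r≈1 = begin
      δ r r - δ r' r ≈⟨ +-cong (ι-var-diag r) (-‿cong (ι-var-offdiag (r≢r' ∘ ≡.sym))) ⟩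
      1# - 0#        ≈⟨ trans (+-congˡ -0#≈0#) (+-identityʳ 1#) ⟩
      1#             ∎

    lincomb≈0 : _≈v_ 𝔽 n (lincomb 𝔽 n cs w) (0v 𝔽 n)
    lincomb≈0 t = begin
      ΣK 𝔽 (λ s → (δ r s - δ r' s) * w s t)
        ≈⟨ ΣK-cong (λ s → [y-z]x≈yx-zx (w s t) (δ r s) (δ r' s)) ⟩
      ΣK 𝔽 (λ s → δ r s * w s t - δ r' s * w s t)
        ≈⟨ ΣK-distrib-- (λ s → δ r s * w s t) (λ s → δ r' s * w s t) ⟩
      ΣK 𝔽 (λ s → δ r s * w s t) - ΣK 𝔽 (λ s → δ r' s * w s t)
        ≈⟨ +-cong (ΣK-indicator r (λ s → w s t)) (-‿cong (ΣK-indicator r' (λ s → w s t))) ⟩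
      w r t - w r' t ≈⟨ +-congʳ (wr≈wr' t) ⟩
      w r' t - w r' t ≈⟨ -‿inverseʳ (w r' t) ⟩
      0# ∎

  spanned-head⇒dependent : ∀ {m p} {P : Vect 𝔽 n → Set p} (w : Fin (suc m) → Vect 𝔽 n) →
                           Spans 𝔽 n P (tail w) → P (head w) → ¬ LinIndep 𝔽 n w
  spanned-head⇒dependent w spans P-head li = 0≉1 (sym 1≈0)
    where
    d = proj₁ (spans (head w) P-head)

    lincomb≈0 : _≈v_ 𝔽 n (lincomb 𝔽 n (- 1# ∷ d) w) (0v 𝔽 n)
    lincomb≈0 t = begin
      - 1# * head w t + lincomb 𝔽 n d (tail w) t
        ≈⟨ +-cong (-1*x≈-x (head w t)) (proj₂ (spans (head w) P-head) t) ⟩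
      - head w t + head w t
        ≈⟨ -‿inverseˡ (head w t) ⟩
      0# ∎

    1≈0 : 1# ≈ 0#
    1≈0 = trans (sym (-‿involutive 1#)) (trans (-‿cong (li (- 1# ∷ d) lincomb≈0 zero)) -0#≈0#)

  module _ {m} (x : Vect 𝔽 n) (w : Fin (suc m) → Vect 𝔽 n) (head⊥̸x : ¬ Perp 𝔽 n x (head w)) where

    private
      α = x · head w
      α⁻¹ = proj₁ (inverse α head⊥̸x)

    extend-linIndep : (∀ s → Perp 𝔽 n x (tail w s)) → LinIndep 𝔽 n (tail w) → LinIndep 𝔽 n w
    extend-linIndep tail⊥x li cs lincomb≈0 = λ { zero → c₀≈0 ; (suc s) → li (tail cs) tail≈0 s }
      where
      c₀α≈0 : cs zero * α ≈ 0#
      c₀α≈0 = begin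
        cs zero * α
          ≈⟨ sym (+-identityʳ _) ⟩
        cs zero * α + 0#
          ≈⟨ +-congˡ (sym (ΣK-zero λ s → trans (*-congˡ (tail⊥x s)) (zeroʳ _))) ⟩
        cs zero * α + ΣK 𝔽 (λ s → cs (suc s) * (x · tail w s))
          ≈⟨ sym (·-lincomb x cs w) ⟩
        x · lincomb 𝔽 n cs w
          ≈⟨ ·-congˡ x lincomb≈0 ⟩
        x · 0v 𝔽 n
          ≈⟨ ·-zeroʳ x ⟩
        0# ∎

      c₀≈0 : cs zero ≈ 0#
      c₀≈0 = x*y≈0⇒x≈0 head⊥̸x c₀α≈0

      tail≈0 : _≈v_ 𝔽 n (lincomb 𝔽 n (tail cs) (tail w)) (0v 𝔽 n)
      tail≈0 t = begin
        lincomb 𝔽 n (tail cs) (tail w) t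
          ≈⟨ sym (+-identityˡ _) ⟩
        0# + lincomb 𝔽 n (tail cs) (tail w) t
          ≈⟨ +-congʳ (sym (trans (*-congʳ c₀≈0) (zeroˡ _))) ⟩
        cs zero * head w t + lincomb 𝔽 n (tail cs) (tail w) t
          ≈⟨ lincomb≈0 t ⟩
        0# ∎

    -- λu is chosen so that u' = u - λu · head w lies in x⊥; then u = λu · head w + u'.
    extend-spans : Spans 𝔽 n (Perp 𝔽 n x) (tail w) → Spans 𝔽 n (Whole 𝔽 n) w
    extend-spans spans u _ = λu ∷ d , lincomb≈u
      where
      λu = (x · u) * α⁻¹
      u' : Vect 𝔽 n
      u' t = u t - λu * head w t

      λuα≈x·u : λu * α ≈ x · u
      λuα≈x·u = begin
        (x · u) * α⁻¹ * α   ≈⟨ *-assoc _ _ _ ⟩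
        (x · u) * (α⁻¹ * α) ≈⟨ *-congˡ (trans (*-comm _ _) (proj₂ (inverse α head⊥̸x))) ⟩
        (x · u) * 1#        ≈⟨ *-identityʳ _ ⟩
        x · u               ∎

      u'⊥x : Perp 𝔽 n x u'
      u'⊥x = begin
        x · u'         ≈⟨ ·-linearʳ x u (head w) λu ⟩
        x · u - λu * α ≈⟨ +-congˡ (-‿cong λuα≈x·u) ⟩
        x · u - x · u  ≈⟨ -‿inverseʳ (x · u) ⟩
        0#             ∎

      d = proj₁ (spans u' u'⊥x)

      lincomb≈u : _≈v_ 𝔽 n (lincomb 𝔽 n (λu ∷ d) w) u
      lincomb≈u t = begin
        λu * head w t + lincomb 𝔽 n d (tail w) t ≈⟨ +-congˡ (proj₂ (spans u' u'⊥x) t) ⟩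
        λu * head w t + (u t - λu * head w t)    ≈⟨ sym (+-assoc _ _ _) ⟩
        λu * head w t + u t - λu * head w t      ≈⟨ xyx⁻¹≈y _ _ ⟩
        u t                                      ∎

    basis-extend : IsBasisOf 𝔽 n (Perp 𝔽 n x) (tail w) → IsBasisOf 𝔽 n (Whole 𝔽 n) w
    basis-extend (tail⊥x , li , spans) = (λ _ → tt) , extend-linIndep tail⊥x li , extend-spans spans

module IndexedFamilies {c ℓ} (𝔽 : Field c ℓ) (n : ℕ) {N} (v : Fin N → Vect 𝔽 n) where

  open Field 𝔽 hiding (zero)
  open FieldSums 𝔽
  open LinearAlgebra 𝔽 n

  pushCoeff : ∀ {m} → (Fin m → Fin N) → (Fin m → Carrier) → Fin N → Carrier
  pushCoeff w cs t with Finₚ.any? (λ s → w s Fin.≟ t)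
  ... | yes (s , _) = cs s
  ... | no _        = 0#

  pushCoeff-∘ : ∀ {m} (w : Fin m → Fin N) (cs : Fin m → Carrier) → Injective _≡_ _≡_ w →
                ∀ s → pushCoeff w cs (w s) ≡ cs s
  pushCoeff-∘ w cs inj s with Finₚ.any? (λ s' → w s' Fin.≟ w s)
  ... | yes (s' , ws'≡ws) = ≡.cong cs (inj ws'≡ws)
  ... | no ∄s'            = ⊥-elim (∄s' (s , ≡.refl))

  module _ {m₁ m₂} (w₁ : Fin m₁ → Fin N) (w₂ : Fin m₂ → Fin N)
           (w₁≗w₂ : monExp w₁ ≗ monExp w₂) where

    lincomb-reindex : (C : Fin N → Carrier) →
                      _≈v_ 𝔽 n (lincomb 𝔽 n (C ∘ w₁) (v ∘ w₁)) (lincomb 𝔽 n (C ∘ w₂) (v ∘ w₂))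
    lincomb-reindex C t = ΣK-reindex w₁ w₂ w₁≗w₂ (λ y → C y * v y t)

    members-transfer : ∀ {p} {P : Vect 𝔽 n → Set p} → (∀ s → P (v (w₂ s))) → ∀ s → P (v (w₁ s))
    members-transfer {P = P} P-w₂ s =
      let s' , w₂s'≡w₁s = image-transfer w₁ w₂ w₁≗w₂ s in
      ≡.subst (P ∘ v) w₂s'≡w₁s (P-w₂ s')

    linIndep-transfer : Injective _≡_ _≡_ w₁ → LinIndep 𝔽 n (v ∘ w₂) → LinIndep 𝔽 n (v ∘ w₁)
    linIndep-transfer inj₁ li₂ cs lincomb≈0 s =
      let s' , w₂s'≡w₁s = image-transfer w₁ w₂ w₁≗w₂ s in
      trans (reflexive (≡.sym (≡.trans (≡.cong C w₂s'≡w₁s) (pushCoeff-∘ w₁ cs inj₁ s))))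
            (li₂ (C ∘ w₂) C∘w₂-relation s')
      where
      C = pushCoeff w₁ cs
      C∘w₂-relation : _≈v_ 𝔽 n (lincomb 𝔽 n (C ∘ w₂) (v ∘ w₂)) (0v 𝔽 n)
      C∘w₂-relation t =
        trans (sym (lincomb-reindex C t))
              (trans (lincomb-cong (v ∘ w₁) (reflexive ∘ pushCoeff-∘ w₁ cs inj₁) t) (lincomb≈0 t))

    spans-transfer : ∀ {p} {P : Vect 𝔽 n → Set p} → Injective _≡_ _≡_ w₂ →
                     Spans 𝔽 n P (v ∘ w₂) → Spans 𝔽 n P (v ∘ w₁)
    spans-transfer inj₂ spans u Pu =
      let ds , lincomb≈u = spans u Pu
          D = pushCoeff w₂ ds in
      D ∘ w₁ ,
      λ t → trans (lincomb-reindex D t)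
                  (trans (lincomb-cong (v ∘ w₂) (reflexive ∘ pushCoeff-∘ w₂ ds inj₂) t)
                         (lincomb≈u t))

    basis-transfer : ∀ {p} {P : Vect 𝔽 n → Set p} → Squarefree (monExp w₂) →
                     IsBasisOf 𝔽 n P (v ∘ w₂) → IsBasisOf 𝔽 n P (v ∘ w₁)
    basis-transfer {P = P} sq (members , li , spans) =
        members-transfer {P = P} members
      , linIndep-transfer (squarefree⇒injective w₁ sq₁) li
      , spans-transfer (squarefree⇒injective w₂ sq) spans
      where
      sq₁ : Squarefree (monExp w₁)
      sq₁ t = ≡.subst (ℕ._≤ 1) (≡.sym (w₁≗w₂ t)) (sq t)

module FiniteFields {c ℓ} (𝔽 : Field c ℓ) {q}
                    (enum : Inverse (Field.setoid 𝔽) (≡.setoid (Fin q))) where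

  open Field 𝔽 hiding (zero)
  open Inverse enum using (to; from; strictlyInverseʳ)
  open import Data.Vec.Functional using (Vector)
  open import Function.Properties.Inverse using (Inverse⇒Injection)
  open import Relation.Binary.Definitions using (Decidable)
  open import Relation.Nullary.Decidable using (via-injection; decidable-stable)

  _≈?_ : Decidable _≈_
  _≈?_ = via-injection (Inverse⇒Injection enum) Fin._≟_

  ∃?-vector : ∀ m {p} (P : Vector Carrier m → Set p) →
              (∀ cs ds → (∀ s → cs s ≈ ds s) → P cs → P ds) → (∀ cs → Dec (P cs)) → Dec (∃ P)
  ∃?-vector zero P resp P? with P? (λ ())
  ... | yes P[] = yes (_ , P[])
  ... | no ¬P[] = no λ (cs , Pcs) → ¬P[] (resp cs _ (λ ()) Pcs)
  ∃?-vector (suc m) P resp P?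
    with Finₚ.any? (λ y → ∃?-vector m (P ∘ (from y ∷_))
                            (λ cs ds cs≈ds → resp _ _ λ { zero → refl ; (suc s) → cs≈ds s })
                            (P? ∘ (from y ∷_)))
  ... | yes (y , cs , Pcs) = yes (from y ∷ cs , Pcs)
  ... | no ∄y = no λ (cs , Pcs) →
    ∄y (to (head cs) , tail cs ,
        resp cs _ (λ { zero → sym (strictlyInverseʳ (head cs)) ; (suc s) → refl }) Pcs)

  basis-stable : ∀ n {m} (w : Fin m → Vect 𝔽 n) →
                 ¬ ¬ IsBasisOf 𝔽 n (Whole 𝔽 n) w → IsBasisOf 𝔽 n (Whole 𝔽 n) w
  basis-stable n {m} w ¬¬basis = (λ _ → tt) , linIndep , spans
    where
    open FieldSums 𝔽 using (ΣK-cong)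

    linIndep : LinIndep 𝔽 n w
    linIndep cs lincomb≈0 s = decidable-stable (cs s ≈? 0#)
      λ cs≉0 → ¬¬basis λ (_ , li , _) → cs≉0 (li cs lincomb≈0 s)

    spans : Spans 𝔽 n (Whole 𝔽 n) w
    spans u _ = decidable-stable
      (∃?-vector m (λ cs → _≈v_ 𝔽 n (lincomb 𝔽 n cs w) u)
        (λ cs ds cs≈ds lincomb≈u t → trans (ΣK-cong λ s → *-congʳ (sym (cs≈ds s))) (lincomb≈u t))
        (λ cs → Finₚ.all? λ t → lincomb 𝔽 n cs w t ≈? u t))
      λ ∄cs → ¬¬basis λ (_ , _ , sp) → ∄cs (sp u _)

module Action {c ℓ} (K : Field c ℓ) (N : ℕ) where

  open Field K hiding (zero)
  open import Algebra.Properties.Ring ring using (-1*x≈-x)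
  open import Data.List using ([]; _∷_; _++_)
  open import Relation.Binary.Reasoning.Setoid setoid

  _∘ᴷ_ : Q K N → R K N → R K N
  _∘ᴷ_ = _∘Q_ K N

  act : Exp N → R K N → R K N
  act a f b = ι K (ΠN (λ t → fall (b t ℕ.+ a t) (a t))) * f (b +e a)

  mono-∘ᴷ : ∀ a f b → (mono K N a ∘ᴷ f) b ≈ act a f b
  mono-∘ᴷ a f b = trans (+-identityʳ _) (*-identityˡ _)

  mono-·Q-mono-∘ᴷ : ∀ a a' f b →
                    ((_·Q_ K N (mono K N a) (mono K N a')) ∘ᴷ f) b ≈ act (a +e a') f b
  mono-·Q-mono-∘ᴷ a a' f b = trans (+-identityʳ _) (trans (*-congʳ (*-identityˡ 1#)) (*-identityˡ _))

  ∘ᴷ-++ : ∀ h h' f b → ((h ++ h') ∘ᴷ f) b ≈ (h ∘ᴷ f) b + (h' ∘ᴷ f) b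
  ∘ᴷ-++ []             h' f b = sym (+-identityˡ _)
  ∘ᴷ-++ ((c , a) ∷ h) h' f b = trans (+-congˡ (∘ᴷ-++ h h' f b)) (sym (+-assoc _ _ _))

  ∘ᴷ-scale : ∀ d h f b → (scaleQ K N d h ∘ᴷ f) b ≈ d * (h ∘ᴷ f) b
  ∘ᴷ-scale d []             f b = sym (zeroʳ d)
  ∘ᴷ-scale d ((c , a) ∷ h) f b =
    trans (+-cong (*-assoc d c _) (∘ᴷ-scale d h f b)) (sym (distribˡ d _ _))

  ∘ᴷ-difference : ∀ h h' f b → (_-Q_ K N h h' ∘ᴷ f) b ≈ (h ∘ᴷ f) b - (h' ∘ᴷ f) b
  ∘ᴷ-difference h h' f b =
    trans (∘ᴷ-++ h _ f b) (+-congˡ (trans (∘ᴷ-scale (- 1#) h' f b) (-1*x≈-x _)))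

  annihilates-difference : ∀ h h' f → (∀ b → (h ∘ᴷ f) b ≈ (h' ∘ᴷ f) b) →
                           InAnn K N f (_-Q_ K N h h')
  annihilates-difference h h' f h≈h' b = begin
    (_-Q_ K N h h' ∘ᴷ f) b    ≈⟨ ∘ᴷ-difference h h' f b ⟩
    (h ∘ᴷ f) b - (h' ∘ᴷ f) b  ≈⟨ +-congʳ (h≈h' b) ⟩
    (h' ∘ᴷ f) b - (h' ∘ᴷ f) b ≈⟨ -‿inverseʳ _ ⟩
    0#                        ∎

module BasisMonomials {c ℓ c' ℓ'} (𝔽 : Field c ℓ) (K : Field c' ℓ') (n : ℕ) {N}
                      (v : Fin N → Vect 𝔽 n) where

  open LinearAlgebra 𝔽 n
  open IndexedFamilies 𝔽 n v
  open import Data.Nat using (_≤_; _≤?_)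
  import Data.Nat.Properties as ℕₚ
  open import Relation.Nullary.Decidable using (decidable-stable)

  BasisMonomial : Exp N → Set _
  BasisMonomial = IsBasisMonomial 𝔽 K n N v

  basisMonomial-resp : ∀ {a a'} → a ≗ a' → BasisMonomial a → BasisMonomial a'
  basisMonomial-resp a≗a' (i , inc , a≗i , basis) =
    i , inc , (λ t → ≡.trans (≡.sym (a≗a' t)) (a≗i t)) , basis

  basisMonomial-deg : ∀ {a} → BasisMonomial a → deg a ≡ n
  basisMonomial-deg (i , _ , a≗i , _) = ≡.trans (ΣN-cong a≗i) (deg-monExp i)

  basisMonomial-squarefree : ∀ {a} → BasisMonomial a → Squarefree a
  basisMonomial-squarefree (i , inc , a≗i , _) t =
    ≡.subst (_≤ 1) (≡.sym (a≗i t)) (injective⇒squarefree i (strictlyIncreasing⇒injective i inc) t)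

  basisMonomial⇒basis : ∀ {m} (w : Fin m → Fin N) → BasisMonomial (monExp w) →
                        IsBasisOf 𝔽 n (Whole 𝔽 n) (v ∘ w)
  basisMonomial⇒basis w bm@(i , _ , w≗i , basis) =
    basis-transfer w i w≗i (basisMonomial-squarefree (basisMonomial-resp w≗i bm)) basis

  basis⇒basisMonomial : (w : Fin n → Fin N) → IsBasisOf 𝔽 n (Whole 𝔽 n) (v ∘ w) →
                        BasisMonomial (monExp w)
  basis⇒basisMonomial w basis@(_ , li , _) =
    i , inc , (≡.sym ∘ i≗w) , basis-transfer i w i≗w sq basis
    where
    sq : Squarefree (monExp w)
    sq = injective⇒squarefree w λ {s} {s'} ws≡ws' →
      linIndep⇒distinct (v ∘ w) li s s' (λ t → Field.reflexive 𝔽 (≡.cong (λ y → v y t) ws≡ws'))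
    sorted = squarefree⇒sorted n (monExp w) sq (deg-monExp w)
    i = proj₁ sorted
    inc = proj₁ (proj₂ sorted)
    i≗w = proj₂ (proj₂ sorted)

  basisMonomial-stable : ∀ {q} → Inverse (Field.setoid 𝔽) (≡.setoid (Fin q)) →
                         ∀ {a} → ¬ ¬ BasisMonomial a → BasisMonomial a
  basisMonomial-stable enum {a} ¬¬bm = i , inc , (≡.sym ∘ i≗a) , basis
    where
    open FiniteFields 𝔽 enum using (basis-stable)
    sq : Squarefree a
    sq t = decidable-stable (a t ≤? 1) λ ≰1 → ¬¬bm λ bm → ≰1 (basisMonomial-squarefree bm t)
    deg≡n : deg a ≡ n
    deg≡n = decidable-stable (deg a ℕₚ.≟ n) λ ≢n → ¬¬bm λ bm → ≢n (basisMonomial-deg bm)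
    sorted = squarefree⇒sorted n a sq deg≡n
    i = proj₁ sorted
    inc = proj₁ (proj₂ sorted)
    i≗a = proj₂ (proj₂ sorted)
    basis : IsBasisOf 𝔽 n (Whole 𝔽 n) (v ∘ i)
    basis = basis-stable n (v ∘ i) λ ¬basis →
      ¬¬bm λ bm → ¬basis (basisMonomial⇒basis i (basisMonomial-resp (≡.sym ∘ i≗a) bm))

module Apolarity {c ℓ c' ℓ'} (𝔽 : Field c ℓ) (K : Field c' ℓ') (n : ℕ) {N} (v : Fin N → Vect 𝔽 n)
                 (F : R K N) (F-def : IsBasisPolynomial 𝔽 K n N v F) where

  open Field K hiding (zero)
  open FieldSums K using (ι-one)
  open Action K N
  open BasisMonomials 𝔽 K n v
  import Data.Nat.Properties as ℕₚ
  import Data.List.Relation.Unary.All as All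
  open import Algebra.Properties.Ring ring using (-0#≈0#)
  open import Relation.Binary.Reasoning.Setoid setoid

  act-nonbasis : ∀ a b → ¬ BasisMonomial (b +e a) → act a F b ≈ 0#
  act-nonbasis a b ¬bm = trans (*-congˡ (proj₂ (F-def (b +e a)) ¬bm)) (zeroʳ _)

  act-basis : ∀ {a b} → BasisMonomial a → (∀ t → b t ≡ 0) → act a F b ≈ 1#
  act-basis {a} {b} bm b≡0 = begin
    ι K (ΠN (λ t → fall (b t ℕ.+ a t) (a t))) * F (b +e a)
      ≈⟨ *-cong (reflexive (≡.cong (ι K) (ΠN-one fall≡1))) (proj₁ (F-def (b +e a)) b+a-basis) ⟩
    ι K 1 * 1# ≈⟨ trans (*-identityʳ _) ι-one ⟩
    1# ∎
    where
    fall≡1 : ∀ t → fall (b t ℕ.+ a t) (a t) ≡ 1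
    fall≡1 t rewrite b≡0 t = fall-diag (basisMonomial-squarefree bm t)
    b+a-basis : BasisMonomial (b +e a)
    b+a-basis = basisMonomial-resp (λ t → ≡.cong (ℕ._+ a t) (≡.sym (b≡0 t))) bm

  basisMonomial-shift : ∀ {a b} → deg a ≡ n → BasisMonomial (b +e a) → ∀ t → b t ≡ 0
  basisMonomial-shift {a} {b} deg-a bm = ΣN≡0⇒zero b (ℕₚ.+-cancelʳ-≡ n (deg b) 0 deg-b+n≡n)
    where
    deg-b+n≡n : deg b ℕ.+ n ≡ n
    deg-b+n≡n = ≡.trans (≡.cong (deg b ℕ.+_) (≡.sym deg-a))
                        (≡.trans (≡.sym (ΣN-distrib-+ b a)) (basisMonomial-deg bm))

  basisMonomials-act-alike : ∀ {a a'} → BasisMonomial a → BasisMonomial a' →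
                             ∀ b → act a F b ≈ act a' F b
  basisMonomials-act-alike bm bm' b with Finₚ.all? (λ t → b t ℕ.≟ 0)
  ... | yes b≡0 = trans (act-basis bm b≡0) (sym (act-basis bm' b≡0))
  ... | no b≢0  = trans (act-nonbasis _ b (b≢0 ∘ basisMonomial-shift (basisMonomial-deg bm)))
                        (sym (act-nonbasis _ b (b≢0 ∘ basisMonomial-shift (basisMonomial-deg bm'))))

  generator-basisMonomial : ∀ {a g} → BasisMonomial a → GeneratesA K N F n (mono K N g) →
                            ¬ ¬ BasisMonomial g
  generator-basisMonomial {a} {g} bm generates ¬bm-g = 0≉1 (sym 1≈0)
    where
    0̂ : Exp N
    0̂ _ = 0
    a-homogeneous = basisMonomial-deg bm All.∷ All.[]
    α = proj₁ (generates (mono K N a) a-homogeneous)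
    1≈0 : 1# ≈ 0#
    1≈0 = begin
      1#
        ≈⟨ sym (trans (+-congˡ -0#≈0#) (+-identityʳ 1#)) ⟩
      1# - 0#
        ≈⟨ sym (+-cong (act-basis bm λ _ → ≡.refl) (-‿cong (trans (*-congˡ act-g≈0) (zeroʳ α)))) ⟩
      act a F 0̂ - α * act g F 0̂
        ≈⟨ sym (+-cong (mono-∘ᴷ a F 0̂)
                       (-‿cong (trans (∘ᴷ-scale α (mono K N g) F 0̂) (*-congˡ (mono-∘ᴷ g F 0̂))))) ⟩
      (mono K N a ∘ᴷ F) 0̂ - (scaleQ K N α (mono K N g) ∘ᴷ F) 0̂
        ≈⟨ sym (∘ᴷ-difference (mono K N a) (scaleQ K N α (mono K N g)) F 0̂) ⟩
      (_-Q_ K N (mono K N a) (scaleQ K N α (mono K N g)) ∘ᴷ F) 0̂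
        ≈⟨ proj₂ (generates (mono K N a) a-homogeneous) 0̂ ⟩
      0# ∎
      where
      act-g≈0 : act g F 0̂ ≈ 0#
      act-g≈0 = act-nonbasis g 0̂ (¬bm-g ∘ basisMonomial-resp λ _ → ≡.refl)

open import Data.Nat using (_≤_; _*_; _∸_; _^_)

proposition4p10 : ∀ {c ℓ c' ℓ' : Level}
    (𝔽 : Field c ℓ) (q : ℕ) → Inverse (Field.setoid 𝔽) (≡.setoid (Fin q)) →
    (n : ℕ) → 1 ≤ n →
    (N : ℕ) → N * (q ∸ 1) ≡ q ^ n ∸ 1 →
    (v : Fin N → Vect 𝔽 n) → IsLineEnumeration 𝔽 n v →
    (K : Field c' ℓ') → CharZero K →
    (F : R K N) → IsBasisPolynomial 𝔽 K n N v F →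
    (g : Exp N) → deg g ≡ n → GeneratesA K N F n (mono K N g) →
    (i j : Fin N) →
    (k : Fin (n ∸ 1) → Fin N) → IsBasisOf 𝔽 n (Perp 𝔽 n (v j)) (λ s → v (k s)) →
    (Perp 𝔽 n (v j) (v i) →
        InAnn K N F (_·Q_ K N (mono K N (var i)) (mono K N (monExp k))))
    × (¬ Perp 𝔽 n (v j) (v i) →
        InAnn K N F (_-Q_ K N (_·Q_ K N (mono K N (var i)) (mono K N (monExp k)))
                              (mono K N g)))
proposition4p10 𝔽 q enum (suc m) _ N _ v _ K _ F F-def g _ generates i j k k-basis =
  perpendicular , transversal
  where
  open Field K using (trans; sym)
  open LinearAlgebra 𝔽 (suc m) using (spanned-head⇒dependent; basis-extend)
  open BasisMonomials 𝔽 K (suc m) v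
  open Action K N
  open Apolarity 𝔽 K (suc m) v F F-def

  -- monExp w is, pointwise and definitionally, the exponent var i +e monExp k of x_i · x^k.
  w : Fin (suc m) → Fin N
  w = i ∷ k

  xᵢxᵏ = _·Q_ K N (mono K N (var i)) (mono K N (monExp k))

  perpendicular : Perp 𝔽 (suc m) (v j) (v i) → InAnn K N F xᵢxᵏ
  perpendicular vi⊥vj b =
    trans (mono-·Q-mono-∘ᴷ (var i) (monExp k) F b) (act-nonbasis (monExp w) b nonbasis)
    where
    nonbasis : ¬ BasisMonomial (b +e monExp w)
    nonbasis bm = spanned-head⇒dependent (v ∘ w) (proj₂ (proj₂ k-basis)) vi⊥vj
      (proj₁ (proj₂ (basisMonomial⇒basis w (basisMonomial-resp b+w≗w bm))))
      where
      b+w≗w : b +e monExp w ≗ monExp w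
      b+w≗w t = ≡.cong (ℕ._+ monExp w t) (basisMonomial-shift {b = b} (deg-monExp w) bm t)

  transversal : ¬ Perp 𝔽 (suc m) (v j) (v i) → InAnn K N F (_-Q_ K N xᵢxᵏ (mono K N g))
  transversal vi⊥̸vj = annihilates-difference xᵢxᵏ (mono K N g) F λ b →
    trans (mono-·Q-mono-∘ᴷ (var i) (monExp k) F b)
          (trans (basisMonomials-act-alike w-basis g-basis b) (sym (mono-∘ᴷ g F b)))
    where
    w-basis = basis⇒basisMonomial w (basis-extend (v j) (v ∘ w) vi⊥̸vj k-basis)
    g-basis = basisMonomial-stable enum (generator-basisMonomial w-basis generates)
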